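{- Let $H$ be any graph of order $r$, $2\leq r\leq n$, without isolated vertices, and let $G$ be a generalized corona of $H$ having exactly $n$ leaves. For each $\ell$ with $0\leq \ell\leq n$, $D_{r+\ell}^t(G)$ is isomorphic to the subgraph of $Q_n$ induced by the collection of all $k$-subsets, $0\leq k\leq \ell$, of an $n$-set.
   Context: A generalized corona of a graph $H$ is a graph obtained by joining each vertex of $H$ to one or more new leaves (vertices of degree $1$). The hypercube $Q_n$ is the graph whose vertices are the $2^n$ subsets of an $n$-set, two being adjacent if and only if one is obtained from the other by deleting a single element. A total dominating set (TDS) of a graph without isolated vertices is a vertex set $S$ such that every vertex is adjacent to a vertex of $S$. For a positive integer $k$, $D_k^t(G)$ is the graph whose vertices are the TDSs of $G$ of cardinality at most $k$, two being adjacent if and only if one is obtained from the other by adding or deleting a single vertex. -}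

module Defs where

open import Data.Nat using (ℕ; _≤_; _+_)
open import Data.Fin using (Fin; splitAt)
open import Data.Fin.Subset using (Subset; _∈_; _∉_; _∪_; ⁅_⁆; ∣_∣)
open import Data.Sum using (_⊎_; inj₁; inj₂)
open import Data.Product using (Σ; ∃; _×_; _,_)
open import Data.Empty using (⊥)
open import Relation.Nullary using (¬_)
open import Relation.Binary.PropositionalEquality using (_≡_)
open import Function.Bundles using (_↔_; Inverse; _⇔_)

record Graph (N : ℕ) : Set₁ where
  field
    Adj    : Fin N → Fin N → Set
    sym    : ∀ {u v} → Adj u v → Adj v u
    irrefl : ∀ {v} → ¬ Adj v v
open Graph public

NoIsolated : ∀ {N} → Graph N → Set
NoIsolated G = ∀ v → ∃ λ u → Adj G v u

-- Generalized corona: vertices Fin (r + n); the first r are the vertices of H,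
-- the last n are the leaves; leaf j is joined to the H-vertex (owner j).
-- Each H-vertex gets at least one leaf iff owner is surjective.
Surjective : ∀ {a b} → (Fin a → Fin b) → Set
Surjective f = ∀ y → ∃ λ x → f x ≡ y

coronaAdj⊎ : ∀ {r n} → Graph r → (Fin n → Fin r) → Fin r ⊎ Fin n → Fin r ⊎ Fin n → Set
coronaAdj⊎ H o (inj₁ a) (inj₁ b) = Adj H a b
coronaAdj⊎ H o (inj₁ a) (inj₂ j) = o j ≡ a
coronaAdj⊎ H o (inj₂ j) (inj₁ a) = o j ≡ a
coronaAdj⊎ H o (inj₂ i) (inj₂ j) = ⊥

coronaSym : ∀ {r n} (H : Graph r) (o : Fin n → Fin r) x y →
            coronaAdj⊎ H o x y → coronaAdj⊎ H o y x
coronaSym H o (inj₁ a) (inj₁ b) p = Graph.sym H p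
coronaSym H o (inj₁ a) (inj₂ j) p = p
coronaSym H o (inj₂ j) (inj₁ a) p = p

coronaIrr : ∀ {r n} (H : Graph r) (o : Fin n → Fin r) x → ¬ coronaAdj⊎ H o x x
coronaIrr H o (inj₁ a) p = irrefl H p
coronaIrr H o (inj₂ j) ()

corona : ∀ {r n} → Graph r → (Fin n → Fin r) → Graph (r + n)
corona {r} H o = record
  { Adj    = λ x y → coronaAdj⊎ H o (splitAt r x) (splitAt r y)
  ; sym    = λ {x} {y} → coronaSym H o (splitAt r x) (splitAt r y)
  ; irrefl = λ {x} → coronaIrr H o (splitAt r x)
  }

IsTDS : ∀ {N} → Graph N → Subset N → Set
IsTDS G S = ∀ v → ∃ λ u → u ∈ S × Adj G v u

record AGraph : Set₁ where
  field
    Vtx  : Set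
    AAdj : Vtx → Vtx → Set
open AGraph public

-- Subtype with proof-irrelevant membership proof (so elements are determined by the set).
record Sub {A : Set} (P : A → Set) : Set where
  constructor ⟨_,_⟩
  field
    elem   : A
    .proof : P elem
open Sub public

AddOne : ∀ {N} → Subset N → Subset N → Set
AddOne S T = ∃ λ v → v ∉ S × T ≡ S ∪ ⁅ v ⁆

AddDel : ∀ {N} → Subset N → Subset N → Set
AddDel S T = AddOne S T ⊎ AddOne T S

Dt : ∀ {N} → ℕ → Graph N → AGraph
Dt {N} k G = record
  { Vtx  = Sub {Subset N} (λ S → IsTDS G S × ∣ S ∣ ≤ k)
  ; AAdj = λ S T → AddDel (elem S) (elem T)
  }

QLayers : ℕ → ℕ → AGraph
QLayers n ℓ = record
  { Vtx  = Sub {Subset n} (λ S → ∣ S ∣ ≤ ℓ)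
  ; AAdj = λ S T → AddDel (elem S) (elem T)
  }

record _≅_ (A B : AGraph) : Set where
  field
    bij : Vtx A ↔ Vtx B
    adj : ∀ x y → AAdj A x y ⇔ AAdj B (Inverse.to bij x) (Inverse.to bij y)

-- The vertices of G are Fin (r + n): the H-vertices a ↑ˡ n come first, the
-- leaves r ↑ʳ j last, so a vertex set of G is a concatenation S = p ++ L of a
-- subset p of V(H) and a set L of leaves.
--
-- The whole proof rests on one observation: S is a TDS of G iff S ⊇ V(H),
-- i.e. iff S = ⊤ ++ L.  Indeed the only neighbour of a leaf is its owner, and
-- every H-vertex owns a leaf, so a TDS contains V(H); conversely V(H)
-- dominates every leaf (through its owner) and every H-vertex (since H has no
-- isolated vertex).  Hence S ↦ L is a bijection from the TDSs of size at most
-- r + ℓ onto the sets of at most ℓ leaves, and since a fixed prefix ⊤ does not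
-- affect adding or deleting a single element, it is a graph isomorphism.

module Submission where

open import Defs hiding (sym)
open import Data.Nat using (ℕ; _≤_; _+_; zero; suc)
open import Data.Nat.Properties using (+-cancelˡ-≤; +-monoʳ-≤)
open import Data.Fin using (Fin; _↑ˡ_; _↑ʳ_; splitAt)
open import Data.Fin.Properties using (splitAt-↑ˡ; splitAt-↑ʳ; splitAt⁻¹-↑ˡ; splitAt⁻¹-↑ʳ)
open import Data.Fin.Subset using (Subset; _∈_; _∪_; ⁅_⁆; ∣_∣; ⊤; ⊥; inside; outside)
open import Data.Fin.Subset.Properties using (∈⊤; ⊆⊤; ⊆-antisym; ∣⊤∣≡n; x∈⁅x⁆; q⊆p∪q; ∪-identityʳ)
open import Data.Vec using (_∷_; []; _++_; take; drop)
open import Data.Vec.Properties using (≡-dec; lookup-++ˡ; lookup-++ʳ; []=⇒lookup; lookup⇒[]=; take++drop≡id; ++-injectiveʳ; zipWith-++)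
open import Data.Bool using (_∨_) renaming (_≟_ to _≟ᵇ_)
open import Data.Sum using (inj₁; inj₂)
open import Data.Product using (_,_; _×_; proj₁; proj₂)
open import Data.Empty using (⊥-elim)
open import Relation.Nullary.Decidable using (recompute)
open import Relation.Binary.PropositionalEquality using (_≡_; refl; sym; trans; cong; subst; subst₂; module ≡-Reasoning)
open import Function.Bundles using (_⇔_; mk↔ₛ′; mk⇔)
open Function.Bundles.Equivalence using (to; from)

Sub-≡ : ∀ {A : Set} {P : A → Set} {x y : Sub P} → elem x ≡ elem y → x ≡ y
Sub-≡ {x = ⟨ a , _ ⟩} {⟨ .a , _ ⟩} refl = refl

data Side (r n : ℕ) : Fin (r + n) → Set where
  head : (a : Fin r) → Side r n (a ↑ˡ n)
  tail : (j : Fin n) → Side r n (r ↑ʳ j)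

side : ∀ r {n} (v : Fin (r + n)) → Side r n v
side r v with splitAt r v in eq
... | inj₁ a = subst (Side r _) (splitAt⁻¹-↑ˡ eq) (head a)
... | inj₂ j = subst (Side r _) (splitAt⁻¹-↑ʳ eq) (tail j)

module _ {m n : ℕ} (p : Subset m) (q : Subset n) where

  ∈-++ˡ : ∀ a → (a ↑ˡ n) ∈ p ++ q ⇔ a ∈ p
  ∈-++ˡ a = mk⇔ (λ a∈ → lookup⇒[]= a p (trans (sym (lookup-++ˡ p q a)) ([]=⇒lookup a∈)))
                (λ a∈ → lookup⇒[]= _ (p ++ q) (trans (lookup-++ˡ p q a) ([]=⇒lookup a∈)))

  ∈-++ʳ : ∀ j → (m ↑ʳ j) ∈ p ++ q ⇔ j ∈ q
  ∈-++ʳ j = mk⇔ (λ j∈ → lookup⇒[]= j q (trans (sym (lookup-++ʳ p q j)) ([]=⇒lookup j∈)))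
                (λ j∈ → lookup⇒[]= _ (p ++ q) (trans (lookup-++ʳ p q j) ([]=⇒lookup j∈)))

  drop-++ : drop m (p ++ q) ≡ q
  drop-++ = ++-injectiveʳ (take m (p ++ q)) p (take++drop≡id m (p ++ q))

∣p++q∣ : ∀ {m n} (p : Subset m) (q : Subset n) → ∣ p ++ q ∣ ≡ ∣ p ∣ + ∣ q ∣
∣p++q∣ []            q = refl
∣p++q∣ (inside  ∷ p) q = cong suc (∣p++q∣ p q)
∣p++q∣ (outside ∷ p) q = ∣p++q∣ p q

∣⊤++q∣ : ∀ r {n} (q : Subset n) → ∣ ⊤ {r} ++ q ∣ ≡ r + ∣ q ∣
∣⊤++q∣ r q = trans (∣p++q∣ (⊤ {r}) q) (cong (_+ ∣ q ∣) (∣⊤∣≡n r))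

⁅↑ʳ⁆ : ∀ r {n} (j : Fin n) → ⁅ r ↑ʳ j ⁆ ≡ ⊥ {r} ++ ⁅ j ⁆
⁅↑ʳ⁆ zero    j = refl
⁅↑ʳ⁆ (suc r) j = cong (outside ∷_) (⁅↑ʳ⁆ r j)

++-∪-⁅↑ʳ⁆ : ∀ {m n} (p : Subset m) (q : Subset n) j → (p ++ q) ∪ ⁅ m ↑ʳ j ⁆ ≡ p ++ (q ∪ ⁅ j ⁆)
++-∪-⁅↑ʳ⁆ {m} p q j = begin
  (p ++ q) ∪ ⁅ m ↑ʳ j ⁆    ≡⟨ cong ((p ++ q) ∪_) (⁅↑ʳ⁆ m j) ⟩
  (p ++ q) ∪ (⊥ ++ ⁅ j ⁆)  ≡⟨ zipWith-++ _∨_ p q ⊥ ⁅ j ⁆ ⟩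
  (p ∪ ⊥) ++ (q ∪ ⁅ j ⁆)   ≡⟨ cong (_++ (q ∪ ⁅ j ⁆)) (∪-identityʳ p) ⟩
  p ++ (q ∪ ⁅ j ⁆)         ∎
  where open ≡-Reasoning

full-head : ∀ r {n} (S : Subset (r + n)) → (∀ a → (a ↑ˡ n) ∈ S) → S ≡ ⊤ {r} ++ drop r S
full-head r {n} S heads = begin
  S                        ≡⟨ sym (take++drop≡id r S) ⟩
  take r S ++ drop r S     ≡⟨ cong (_++ drop r S) (⊆-antisym ⊆⊤ (λ {a} _ → head∈ a)) ⟩
  ⊤ {r} ++ drop r S        ∎
  where
  open ≡-Reasoning
  head∈ : ∀ a → a ∈ take r S
  head∈ a = to (∈-++ˡ (take r S) (drop r S) a)
              (subst ((a ↑ˡ n) ∈_) (sym (take++drop≡id r S)) (heads a))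

-- Adding one element to p ++ A gives p ++ B iff adding one element to A gives B:
-- the added element cannot be a head, since heads of p ++ B are those of p ++ A.
AddOne-prefix : ∀ {m n} (p : Subset m) (A B : Subset n) → AddOne (p ++ A) (p ++ B) ⇔ AddOne A B
AddOne-prefix {m} {n} p A B = mk⇔ strip extend
  where
  strip : AddOne (p ++ A) (p ++ B) → AddOne A B
  strip (v , v∉ , eq) with side m v
  ... | head a = ⊥-elim (v∉ (from (∈-++ˡ p A a) (to (∈-++ˡ p B a) a∈)))
    where
    a∈ : (a ↑ˡ n) ∈ p ++ B
    a∈ = subst ((a ↑ˡ n) ∈_) (sym eq) (q⊆p∪q (p ++ A) _ (x∈⁅x⁆ (a ↑ˡ n)))
  ... | tail j = j , (λ j∈ → v∉ (from (∈-++ʳ p A j) j∈))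
                   , ++-injectiveʳ p p (trans eq (++-∪-⁅↑ʳ⁆ p A j))

  extend : AddOne A B → AddOne (p ++ A) (p ++ B)
  extend (j , j∉ , eq) = (m ↑ʳ j) , (λ j∈ → j∉ (to (∈-++ʳ p A j) j∈))
                       , trans (cong (p ++_) eq) (sym (++-∪-⁅↑ʳ⁆ p A j))

AddDel-prefix : ∀ {m n} (p : Subset m) (A B : Subset n) → AddDel (p ++ A) (p ++ B) ⇔ AddDel A B
AddDel-prefix p A B = mk⇔
  (λ { (inj₁ add) → inj₁ (to (AddOne-prefix p A B) add) ; (inj₂ del) → inj₂ (to (AddOne-prefix p B A) del) })
  (λ { (inj₁ add) → inj₁ (from (AddOne-prefix p A B) add) ; (inj₂ del) → inj₂ (from (AddOne-prefix p B A) del) })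

SetGraph : ∀ {N} → (Subset N → Set) → ℕ → AGraph
SetGraph {N} P k = record
  { Vtx  = Sub {Subset N} (λ S → P S × ∣ S ∣ ≤ k)
  ; AAdj = λ S T → AddDel (elem S) (elem T)
  }

module _ {r n : ℕ} (P : Subset (r + n) → Set)
         (P⇒full : ∀ {S} → P S → S ≡ ⊤ {r} ++ drop r S)
         (P-full : ∀ L → P (⊤ {r} ++ L)) where

  -- The shape of S recovered from an irrelevant proof of P S (equality of
  -- subsets is decidable).
  shape : ∀ S → .(P S) → S ≡ ⊤ {r} ++ drop r S
  shape S PS = recompute (≡-dec _≟ᵇ_ S (⊤ {r} ++ drop r S)) (P⇒full PS)

  adjacency : ∀ {S T} (A B : Subset n) → S ≡ ⊤ {r} ++ A → T ≡ ⊤ {r} ++ B → AddDel S T ⇔ AddDel A B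
  adjacency A B refl refl = AddDel-prefix (⊤ {r}) A B

  lowerLayersIso : ∀ ℓ → SetGraph P (r + ℓ) ≅ QLayers n ℓ
  lowerLayersIso ℓ = record
    { bij = mk↔ₛ′ tail-part full-set
                  (λ { ⟨ L , _ ⟩ → Sub-≡ (drop-++ (⊤ {r}) L) })
                  (λ { ⟨ S , prf ⟩ → Sub-≡ (sym (shape S (proj₁ prf))) })
    ; adj = λ { ⟨ S , prfS ⟩ ⟨ T , prfT ⟩ →
                adjacency (drop r S) (drop r T) (shape S (proj₁ prfS)) (shape T (proj₁ prfT)) }
    }
    where
    tail-part : Vtx (SetGraph P (r + ℓ)) → Vtx (QLayers n ℓ)
    tail-part ⟨ S , prf ⟩ = ⟨ drop r S , +-cancelˡ-≤ r _ _
      (subst (_≤ r + ℓ) (trans (cong ∣_∣ (P⇒full (proj₁ prf))) (∣⊤++q∣ r (drop r S))) (proj₂ prf)) ⟩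

    full-set : Vtx (QLayers n ℓ) → Vtx (SetGraph P (r + ℓ))
    full-set ⟨ L , size ⟩ = ⟨ ⊤ {r} ++ L , (P-full L , subst (_≤ r + ℓ) (sym (∣⊤++q∣ r L)) (+-monoʳ-≤ r size)) ⟩

module Corona {r n : ℕ} (H : Graph r) (owner : Fin n → Fin r) where

  G : Graph (r + n)
  G = corona H owner

  edge-H : ∀ {a b} → Adj H a b → Adj G (a ↑ˡ n) (b ↑ˡ n)
  edge-H {a} {b} = subst₂ (coronaAdj⊎ H owner) (sym (splitAt-↑ˡ r a n)) (sym (splitAt-↑ˡ r b n))

  edge-owner : ∀ j → Adj G (r ↑ʳ j) (owner j ↑ˡ n)
  edge-owner j = subst₂ (coronaAdj⊎ H owner) (sym (splitAt-↑ʳ r n j)) (sym (splitAt-↑ˡ r (owner j) n)) refl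

  leaf-neighbour : ∀ {j u} → Adj G (r ↑ʳ j) u → u ≡ owner j ↑ˡ n
  leaf-neighbour {j} {u} adj with side r u
  ... | head b = cong (_↑ˡ n) (sym (subst₂ (coronaAdj⊎ H owner) (splitAt-↑ʳ r n j) (splitAt-↑ˡ r b n) adj))
  ... | tail k = ⊥-elim (subst₂ (coronaAdj⊎ H owner) (splitAt-↑ʳ r n j) (splitAt-↑ʳ r n k) adj)

  -- A TDS contains every H-vertex: it must dominate a leaf owned by that vertex.
  tds-full : Surjective owner → ∀ {S} → IsTDS G S → S ≡ ⊤ {r} ++ drop r S
  tds-full surj {S} tds = full-head r S contains
    where
    contains : ∀ a → (a ↑ˡ n) ∈ S
    contains a with surj a
    ... | j , refl with tds (r ↑ʳ j)
    ...   | u , u∈S , adj = subst (_∈ S) (leaf-neighbour adj) u∈S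

  H-vertex∈ : ∀ {L : Subset n} a → (a ↑ˡ n) ∈ ⊤ {r} ++ L
  H-vertex∈ {L} a = from (∈-++ˡ (⊤ {r}) L a) ∈⊤

  full-tds : NoIsolated H → ∀ L → IsTDS G (⊤ {r} ++ L)
  full-tds noIso L v with side r v
  ... | head a = let b , ab = noIso a in (b ↑ˡ n) , H-vertex∈ b , edge-H ab
  ... | tail j = (owner j ↑ˡ n) , H-vertex∈ (owner j) , edge-owner j

theorem4p1 : (r n : ℕ) → 2 ≤ r → r ≤ n →
    (H : Graph r) → NoIsolated H →
    (owner : Fin n → Fin r) → Surjective owner →
    (ℓ : ℕ) → ℓ ≤ n →
    Dt (r + ℓ) (corona H owner) ≅ QLayers n ℓ
theorem4p1 r n _ _ H noIso owner surj ℓ _ =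
  lowerLayersIso (IsTDS G) (tds-full surj) (full-tds noIso) ℓ
  where open Corona H owner
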